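{- Let $n\ge 1$ and let $\mathcal{C}_n$ be the set of corner-sum hypermatrices of order $n$. Then $\mathcal{C}_n$, partially ordered by entrywise comparison $\ge$, is a lattice.
   Context: A corner-sum hypermatrix of order $n$ is an $(n+1)\times(n+1)\times(n+1)$ integer array $C=(C_{i,j,k})$ with indices $i,j,k\in[0,n]=\{0,1,\dots,n\}$ such that for all $i,j\in[0,n]$: $C_{i,j,0}=C_{i,0,j}=C_{0,i,j}=0$ and $C_{i,j,n}=C_{i,n,j}=C_{n,i,j}=ij$; and for all $i,j\in[0,n]$ and $1\le k\le n$, each of the three differences $C_{i,j,k}-C_{i,j,k-1}$, $C_{i,k,j}-C_{i,k-1,j}$, $C_{k,i,j}-C_{k-1,i,j}$ lies in $\{\max(0,i+j-n),\dots,\min(i,j)\}$. For hypermatrices $C,D$ of the same shape, $C\ge D$ means $C_{i,j,k}\ge D_{i,j,k}$ for all indices. -}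

module Defs where

open import Data.Nat using (ℕ; zero; suc; _∸_; _⊓_) renaming (_+_ to _+ℕ_; _*_ to _*ℕ_)
open import Data.Integer using (ℤ; +_; _-_; _≤_; _≥_)
open import Data.Fin using (Fin; zero; suc; toℕ; fromℕ; inject₁)
open import Data.Product using (Σ; _×_; proj₁)
open import Relation.Binary.PropositionalEquality using (_≡_)

-- Index set [0,n] = Fin (suc n); entries indexed by (i,j,k).
HyperMatrix : ℕ → Set
HyperMatrix n = Fin (suc n) → Fin (suc n) → Fin (suc n) → ℤ

InRange : (n i j : ℕ) → ℤ → Set
InRange n i j d = (+ ((i +ℕ j) ∸ n) ≤ d) × (d ≤ + (i ⊓ j))

record IsCornerSum (n : ℕ) (C : HyperMatrix n) : Set where
  field
    zero₃ : ∀ i j → C i j zero ≡ + 0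
    zero₂ : ∀ i j → C i zero j ≡ + 0
    zero₁ : ∀ i j → C zero i j ≡ + 0
    top₃  : ∀ i j → C i j (fromℕ n) ≡ + (toℕ i *ℕ toℕ j)
    top₂  : ∀ i j → C i (fromℕ n) j ≡ + (toℕ i *ℕ toℕ j)
    top₁  : ∀ i j → C (fromℕ n) i j ≡ + (toℕ i *ℕ toℕ j)
    -- for k ∈ [1,n], written k = suc k' with k' ∈ Fin n, and k-1 = inject₁ k'
    step₃ : ∀ i j (k : Fin n) →
      InRange n (toℕ i) (toℕ j) (C i j (suc k) - C i j (inject₁ k))
    step₂ : ∀ i j (k : Fin n) →
      InRange n (toℕ i) (toℕ j) (C i (suc k) j - C i (inject₁ k) j)
    step₁ : ∀ i j (k : Fin n) →
      InRange n (toℕ i) (toℕ j) (C (suc k) i j - C (inject₁ k) i j)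

CornerSum : ℕ → Set
CornerSum n = Σ (HyperMatrix n) (IsCornerSum n)

_≈_ : ∀ {n} → CornerSum n → CornerSum n → Set
C ≈ D = ∀ i j k → proj₁ C i j k ≡ proj₁ D i j k

_≽_ : ∀ {n} → CornerSum n → CornerSum n → Set
C ≽ D = ∀ i j k → proj₁ C i j k ≥ proj₁ D i j k

module Submission where

-- The boundary values are common to both, and each step condition bounds a difference
-- a' − a by an interval [L, U]; if a' − a and b' − b both lie in [L, U] then so does
-- min(a', b') − min(a, b), because it lies between the two (e.g. b' − b ≤ b' − a ≤ a' − a
-- when a ≤ b and b' ≤ a'). The case of max is the same statement for the negated entries.

open import Algebra.Core using (Op₂)
open import Algebra.Definitions using (Idempotent)
open import Data.Integer using (ℤ; _+_; _-_; -_; _≤_; _⊓_; _⊔_)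
open import Data.Integer.Properties
  using ( ≤-reflexive; ≤-trans; ≤-antisym; ≤-total; +-comm; +-monoˡ-≤; +-monoʳ-≤
        ; neg-involutive; neg-mono-≤; antimono-≤-distrib-⊔
        ; i≤j⇒i⊓j≡i; i≥j⇒i⊓j≡j; ⊓-idem; ⊔-idem; i⊓j≤i; i⊓j≤j; ⊓-glb; i≤i⊔j; i≤j⊔i; ⊔-lub )
open import Data.Nat using (ℕ; _≥_)
open import Data.Product using (Σ; _×_; _,_)
open import Data.Sum using (inj₁; inj₂)
open import Relation.Binary.Lattice.Structures using (IsLattice)
open import Relation.Binary.PropositionalEquality
  using (_≡_; refl; sym; trans; cong; cong₂; subst; module ≡-Reasoning)

open import Defs

infix 4 _∈[_,_]

_∈[_,_] : ℤ → ℤ → ℤ → Set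
d ∈[ L , U ] = L ≤ d × d ≤ U

PreservesDifferenceBounds : Op₂ ℤ → Set
PreservesDifferenceBounds _∙_ = ∀ {L U} a a' b b' →
  a' - a ∈[ L , U ] → b' - b ∈[ L , U ] → (a' ∙ b') - (a ∙ b) ∈[ L , U ]

⊓-preservesDifferenceBounds : PreservesDifferenceBounds _⊓_
⊓-preservesDifferenceBounds a a' b b' (L≤a'-a , a'-a≤U) (L≤b'-b , b'-b≤U)
  with ≤-total a b | ≤-total a' b'
... | inj₁ a≤b | inj₁ a'≤b' rewrite i≤j⇒i⊓j≡i a≤b | i≤j⇒i⊓j≡i a'≤b' = L≤a'-a , a'-a≤U
... | inj₂ b≤a | inj₂ b'≤a' rewrite i≥j⇒i⊓j≡j b≤a | i≥j⇒i⊓j≡j b'≤a' = L≤b'-b , b'-b≤U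
... | inj₁ a≤b | inj₂ b'≤a' rewrite i≤j⇒i⊓j≡i a≤b | i≥j⇒i⊓j≡j b'≤a' =
  ≤-trans L≤b'-b (+-monoʳ-≤ b' (neg-mono-≤ a≤b)) , ≤-trans (+-monoˡ-≤ (- a) b'≤a') a'-a≤U
... | inj₂ b≤a | inj₁ a'≤b' rewrite i≥j⇒i⊓j≡j b≤a | i≤j⇒i⊓j≡i a'≤b' =
  ≤-trans L≤a'-a (+-monoʳ-≤ a' (neg-mono-≤ b≤a)) , ≤-trans (+-monoˡ-≤ (- b) a'≤b') b'-b≤U

x-y≡-y-[-x] : ∀ x y → x - y ≡ - y - - x
x-y≡-y-[-x] x y = trans (+-comm x (- y)) (cong (- y +_) (sym (neg-involutive x)))

neg-distrib-⊔ : ∀ x y → - (x ⊔ y) ≡ - x ⊓ - y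
neg-distrib-⊔ = antimono-≤-distrib-⊔ neg-mono-≤

⊔-preservesDifferenceBounds : PreservesDifferenceBounds _⊔_
⊔-preservesDifferenceBounds {L} {U} a a' b b' a'-a∈ b'-b∈ =
  subst (_∈[ L , U ]) (sym ⊔-difference≡⊓-difference)
    (⊓-preservesDifferenceBounds (- a') (- a) (- b') (- b)
      (subst (_∈[ L , U ]) (x-y≡-y-[-x] a' a) a'-a∈)
      (subst (_∈[ L , U ]) (x-y≡-y-[-x] b' b) b'-b∈))
  where
  open ≡-Reasoning
  ⊔-difference≡⊓-difference : (a' ⊔ b') - (a ⊔ b) ≡ (- a ⊓ - b) - (- a' ⊓ - b')
  ⊔-difference≡⊓-difference = begin
    (a' ⊔ b') - (a ⊔ b)          ≡⟨ x-y≡-y-[-x] (a' ⊔ b') (a ⊔ b) ⟩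
    - (a ⊔ b) - - (a' ⊔ b')      ≡⟨ cong₂ _-_ (neg-distrib-⊔ a b) (neg-distrib-⊔ a' b') ⟩
    (- a ⊓ - b) - (- a' ⊓ - b')  ∎

module _ {n : ℕ} where
  open IsCornerSum

  pointwise : (_∙_ : Op₂ ℤ) → Idempotent _≡_ _∙_ → PreservesDifferenceBounds _∙_ →
              CornerSum n → CornerSum n → CornerSum n
  pointwise _∙_ ∙-idem ∙-bounds (C , c) (D , d) = (λ i j k → C i j k ∙ D i j k) , record
    { zero₃ = λ i j → both (zero₃ c i j) (zero₃ d i j)
    ; zero₂ = λ i j → both (zero₂ c i j) (zero₂ d i j)
    ; zero₁ = λ i j → both (zero₁ c i j) (zero₁ d i j)
    ; top₃  = λ i j → both (top₃ c i j) (top₃ d i j)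
    ; top₂  = λ i j → both (top₂ c i j) (top₂ d i j)
    ; top₁  = λ i j → both (top₁ c i j) (top₁ d i j)
    ; step₃ = λ i j k → ∙-bounds _ _ _ _ (step₃ c i j k) (step₃ d i j k)
    ; step₂ = λ i j k → ∙-bounds _ _ _ _ (step₂ c i j k) (step₂ d i j k)
    ; step₁ = λ i j k → ∙-bounds _ _ _ _ (step₁ c i j k) (step₁ d i j k)
    }
    where
    both : ∀ {x y z} → x ≡ z → y ≡ z → x ∙ y ≡ z
    both {z = z} refl refl = ∙-idem z

  -- The order is ≽, so the supremum of IsLattice is the entrywise minimum.
  ⊓-cornerSum ⊔-cornerSum : CornerSum n → CornerSum n → CornerSum n
  ⊓-cornerSum = pointwise _⊓_ ⊓-idem ⊓-preservesDifferenceBounds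
  ⊔-cornerSum = pointwise _⊔_ ⊔-idem ⊔-preservesDifferenceBounds

  ≽-isLattice : IsLattice (_≈_ {n}) _≽_ ⊓-cornerSum ⊔-cornerSum
  ≽-isLattice = record
    { isPartialOrder = record
      { isPreorder = record
        { isEquivalence = record
          { refl  = λ i j k → refl
          ; sym   = λ C≈D i j k → sym (C≈D i j k)
          ; trans = λ C≈D D≈E i j k → trans (C≈D i j k) (D≈E i j k)
          }
        ; reflexive = λ C≈D i j k → ≤-reflexive (sym (C≈D i j k))
        ; trans     = λ C≽D D≽E i j k → ≤-trans (D≽E i j k) (C≽D i j k)
        }
      ; antisym = λ C≽D D≽C i j k → ≤-antisym (D≽C i j k) (C≽D i j k)
      }
    ; supremum = λ _ _ → (λ i j k → i⊓j≤i _ _) , (λ i j k → i⊓j≤j _ _)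
                       , λ _ C≽E D≽E i j k → ⊓-glb (C≽E i j k) (D≽E i j k)
    ; infimum  = λ _ _ → (λ i j k → i≤i⊔j _ _) , (λ i j k → i≤j⊔i _ _)
                       , λ _ E≽C E≽D i j k → ⊔-lub (E≽C i j k) (E≽D i j k)
    }

mainTheorem1 : (n : ℕ) → n ≥ 1 →
    Σ (CornerSum n → CornerSum n → CornerSum n) λ _∨_ →
    Σ (CornerSum n → CornerSum n → CornerSum n) λ _∧_ →
    IsLattice (_≈_ {n}) (_≽_ {n}) _∨_ _∧_
mainTheorem1 n _ = ⊓-cornerSum , ⊔-cornerSum , ≽-isLattice
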